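{- Let $p,s,t$ be positive integers with $t(t-2)\le s\le t^2$ and $s+t-1\le p$. Then for every $p$-weighted graph $G=(V,w)$ on $n\ge1$ vertices with $\delta(G)>\frac{s(t-1)}{t}\cdot n$, there is $J\subseteq V$ such that $G[J]\in\mathcal{G}_p(p+s+t-1)$.
   Context: A $p$-weighted graph is a pair $G=(V,w)$ with $V$ finite and $w:V^2\to\{0,1,\dots,p\}$ symmetric with $w(x,x)=0$; $d_G(x)=\sum_{y\ne x}w(x,y)$, $\delta(G)=\min_x d_G(x)$, $G[J]=(J,w|_{J^2})$; $G$ is positive if $w(x,y)>0$ for all $x\ne y$. For a positive $p$-weighted graph $G=(V,w)$ with an enumeration $V=\{v_1,\dots,v_m\}$, an extension $w:V\to\{1,\dots,p\}$ is dominating if for every $j\in\{2,\dots,m\}$, writing $a=w(v_j)$, the multiset $\{w(v_i,v_j):i\in[j-1]\}$ dominates the multiset consisting of $j-2$ copies of $\frac{p(a-1)}{a}+1$ and one copy of $a$, as ordered multisets (after sorting both non-decreasingly, entrywise $\ge$). Its size is $\sum_{v}w(v)$. $\mathcal{G}_p(q)$ is the set of positive $p$-weighted graphs admitting an enumeration and a dominating extension of size at least $q$. -}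

module Defs where

open import Data.Nat using (ℕ; zero; suc; _+_; _*_; _∸_; _≤_; _<_; _<ᵇ_)
open import Data.Bool using (Bool; true; false; if_then_else_)
open import Data.Fin using (Fin; toℕ)
open import Data.Fin.Properties using (_≟_)
open import Data.Fin.Permutation using (Permutation′; _⟨$⟩ʳ_)
open import Data.List using (List; []; _∷_; map; filter; replicate; _++_; allFin)
open import Data.Nat.ListAction using (sum)
open import Data.List.Relation.Binary.Pointwise using (Pointwise)
open import Data.Product using (Σ; _×_; ∃; ∃-syntax)
open import Data.Integer using (+_)
open import Data.Rational using (ℚ; _/_; 1ℚ) renaming (_+_ to _+ℚ_; _≤_ to _≤ℚ_)
open import Data.Rational.Properties using (≤-decTotalOrder)
open import Relation.Binary.PropositionalEquality using (_≡_)
open import Relation.Nullary using (¬_)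
open import Relation.Nullary.Decidable using (⌊_⌋)
import Data.Nat as ℕ
import Data.List.Sort

record WGraph (p n : ℕ) : Set where
  field
    w     : Fin n → Fin n → ℕ
    w≤p   : ∀ x y → w x y ≤ p
    wsym  : ∀ x y → w x y ≡ w y x
    wdiag : ∀ x → w x x ≡ 0
open WGraph public

deg : ∀ {p n} → WGraph p n → Fin n → ℕ
deg {n = n} G x = sum (map (λ y → if ⌊ x ≟ y ⌋ then 0 else w G x y) (allFin n))

Positive : ∀ {p n} → WGraph p n → Set
Positive {n = n} G = ∀ (x y : Fin n) → ¬ (x ≡ y) → 0 < w G x y

-- Induced subgraph G[J], where J ⊆ V is given as the image of an injection f : Fin m → Fin n.
induced : ∀ {p n m} → WGraph p n → (f : Fin m → Fin n) → (∀ i j → f i ≡ f j → i ≡ j) → WGraph p m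
induced G f inj = record
  { w     = λ i j → w G (f i) (f j)
  ; w≤p   = λ i j → w≤p G (f i) (f j)
  ; wsym  = λ i j → wsym G (f i) (f j)
  ; wdiag = λ i → wdiag G (f i)
  }

toℚ : ℕ → ℚ
toℚ k = (+ k) / 1

-- the threshold p(a-1)/a + 1 (a ≥ 1; the value at a = 0 is irrelevant)
thr : ℕ → ℕ → ℚ
thr p zero    = 1ℚ
thr p (suc b) = ((+ (p * b)) / suc b) +ℚ 1ℚ

open Data.List.Sort ≤-decTotalOrder using (sort)

Dominates : List ℚ → List ℚ → Set
Dominates L M = Pointwise (λ x y → y ≤ℚ x) (sort L) (sort M)

-- Dominating extension for the enumeration v_{k+1} = σ k (0-based index k).
Dominating : ∀ {p m} → WGraph p m → Permutation′ m → (Fin m → ℕ) → Set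
Dominating {p} {m} G σ e =
  ∀ (j : Fin m) → 1 ≤ toℕ j →
    let a = e (σ ⟨$⟩ʳ j)
        L = map (λ i → toℚ (w G (σ ⟨$⟩ʳ i) (σ ⟨$⟩ʳ j)))
                (filter (λ i → toℕ i ℕ.<? toℕ j) (allFin m))
        M = replicate (toℕ j ∸ 1) (thr p a) ++ (toℚ a ∷ [])
    in Dominates L M

size : ∀ {m} → (Fin m → ℕ) → ℕ
size {m} e = sum (map e (allFin m))

InGp : ∀ {p m} → ℕ → WGraph p m → Set
InGp {p} {m} q G =
  Positive G ×
  Σ (Permutation′ m) λ σ →
  Σ (Fin m → ℕ) λ e →
    (∀ v → 1 ≤ e v × e v ≤ p) × Dominating G σ e × q ≤ size e

-- Greedily choose a maximal clique K of the graph of positive-weight pairs, so that every vertex y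
-- misses some vertex of K. If y has c − 1 neighbours in K and the edge yx to one of them is heavier
-- than s + t − c, then y, x and the remaining neighbours form a clique; enumerated in this order with
-- extension p, w(y, x), 1, …, 1 it lies in 𝒢_p(p + s + t − 1). Otherwise the weight from y into K is
-- at most (c − 1)(s + t − c) ≤ c·s(t − 1)/t ≤ |K|·s(t − 1)/t. If that happens for every y, summing
-- over y double-counts the degrees of the vertices of K and contradicts the degree bound.
module Submission where

open import Defs
open import Data.Nat
  using (ℕ; zero; suc; _+_; _*_; _∸_; _≤_; _<_; z≤n; s≤s; z<s; _≤?_; _<?_; _<ᵇ_; compare; less; equal; greater)
open import Data.Nat.Properties
open import Data.Nat.Tactic.RingSolver using (solve-∀)
open import Algebra.Properties.CommutativeSemigroup +-commutativeSemigroup using (interchange)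
open import Data.Nat.ListAction using (sum)
open import Data.Nat.Coprimality using (1-coprimeTo) renaming (sym to coprime-sym)
import Data.Integer as ℤ
import Data.Integer.Properties as ℤ
open import Data.Rational as ℚ using (ℚ; mkℚ; 1ℚ; *≤*) renaming (_≤_ to _≤ℚ_)
import Data.Rational.Properties as ℚ
open import Data.Bool using (true; false; if_then_else_)
open import Data.Fin using (Fin; zero; suc; toℕ; fromℕ<)
open import Data.Fin.Properties using (toℕ<n; any?) renaming (_≟_ to _≟ᶠ_)
import Data.Fin.Permutation as Permutation
open import Data.List using (List; []; _∷_; length; map; filter; allFin; lookup; replicate; _++_; tabulate)
open import Data.List.Properties
  using ( length-map; length-++; length-replicate; length-tabulate; length-removeAt′
        ; map-tabulate; map-cong; filter-notAll)
open import Data.List.Relation.Unary.All as All using (All; []; _∷_; all?)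
open import Data.List.Relation.Unary.All.Properties using (map⁺; all-filter; ++⁺; replicate⁺; ─⁺)
open import Data.List.Relation.Unary.All.Properties.Core using (¬All⇒Any¬; ¬Any⇒All¬)
open import Data.List.Relation.Unary.Any as Any using (Any; here; there)
open import Data.List.Relation.Unary.Any.Properties using (lookup-result)
open import Data.List.Relation.Unary.AllPairs using (AllPairs; []; _∷_)
import Data.List.Relation.Unary.AllPairs.Properties as AllPairs
open import Data.List.Membership.Propositional using (_∈_)
open import Data.List.Membership.Propositional.Properties using (∈-lookup; ∈-allFin)
open import Data.List.Relation.Binary.Pointwise using (Pointwise; []; _∷_)
open import Data.List.Relation.Binary.Permutation.Propositional using (↭-sym)
open import Data.List.Relation.Binary.Permutation.Propositional.Properties using (All-resp-↭; ↭-length)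
import Data.List.Sort
open import Data.Product using (Σ; _×_; _,_)
open import Data.Empty using (⊥-elim)
open import Function using (_∘_; case_of_)
open import Relation.Nullary using (¬_; Dec; yes; no)
open import Relation.Nullary.Decidable using (⌊_⌋)
open import Relation.Binary.Definitions using (Decidable; Symmetric)
open import Relation.Binary.PropositionalEquality

open Data.List.Sort ℚ.≤-decTotalOrder using (sort-↭)

cancel-≤ : ∀ {l x r y} → l + x ≡ r + y → y ≤ x → l ≤ r
cancel-≤ {l} {x} {r} {y} eq y≤x = +-cancelʳ-≤ x l r (≤-trans (≤-reflexive eq) (+-monoʳ-≤ r y≤x))

clique-weight-bound-below : ∀ m k s → suc (suc (m + k)) * (m + k) ≤ s →
  suc (suc (m + k)) * (m * (s + suc k)) ≤ suc m * (s * suc (m + k))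
clique-weight-bound-below m k s lo = cancel-≤ (balance m k s) (*-monoʳ-≤ (suc k) mT≤s)
  where
  T = suc (suc (m + k))
  balance : ∀ m k s → suc (suc (m + k)) * (m * (s + suc k)) + suc k * s
                    ≡ suc m * (s * suc (m + k)) + suc k * (m * suc (suc (m + k)))
  balance = solve-∀
  mT≤s : m * T ≤ s
  mT≤s = begin
    m * T       ≡⟨ *-comm m T ⟩
    T * m       ≤⟨ *-monoʳ-≤ T (m≤m+n m k) ⟩
    T * (m + k) ≤⟨ lo ⟩
    s           ∎
    where open ≤-Reasoning

clique-weight-bound-above : ∀ u k b → suc k + b ≤ suc u * suc u →
  suc u * (suc (u + k) * b) ≤ suc (suc (u + k)) * ((suc k + b) * u)
clique-weight-bound-above u k b hi = cancel-≤ (balance u k b) (*-monoʳ-≤ (suc k) b≤uT)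
  where
  balance : ∀ u k b → suc u * (suc (u + k) * b) + suc k * (u * suc (suc (u + k)))
                    ≡ suc (suc (u + k)) * ((suc k + b) * u) + suc k * b
  balance = solve-∀
  square-split : ∀ u k → suc k + u * suc (suc (u + k)) ≡ suc u * suc u + k * suc u
  square-split = solve-∀
  b≤uT : b ≤ u * suc (suc (u + k))
  b≤uT = +-cancelˡ-≤ (suc k) b _ (begin
    suc k + b                     ≤⟨ hi ⟩
    suc u * suc u                 ≤⟨ m≤m+n (suc u * suc u) (k * suc u) ⟩
    suc u * suc u + k * suc u     ≡⟨ square-split u k ⟨
    suc k + u * suc (suc (u + k)) ∎)
    where open ≤-Reasoning

+-∸-below : ∀ s m k → s + suc (suc (m + k)) ∸ suc m ≡ s + suc k
+-∸-below s m k = trans (cong (_∸ suc m) (shuffle s m k)) (m+n∸n≡m (s + suc k) (suc m))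
  where
  shuffle : ∀ s m k → s + suc (suc (m + k)) ≡ s + suc k + suc m
  shuffle = solve-∀

+-∸-above : ∀ s u k → s + suc u ∸ suc (suc (u + k)) ≡ s ∸ suc k
+-∸-above s u k = trans (cong₂ _∸_ (+-comm s (suc u)) (shuffle u k)) ([m+n]∸[m+o]≡n∸o (suc u) s (suc k))
  where
  shuffle : ∀ u k → suc (suc (u + k)) ≡ suc u + suc k
  shuffle = solve-∀

-- With t = u + 1 and c = m + 1, the right side minus the left side is (c − t)(tc − s − t), and the
-- two factors have the same sign because t(t − 2) ≤ s ≤ t².
clique-weight-bound : ∀ {s u} m → suc u * (u ∸ 1) ≤ s → s ≤ suc u * suc u →
  suc u * (m * (s + suc u ∸ suc m)) ≤ suc m * (s * u)
clique-weight-bound {s} {u} m lo hi with compare m u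
... | less m k rewrite +-∸-below s m k = clique-weight-bound-below m k s lo
... | equal m rewrite m+n∸n≡m s (suc m) = ≤-reflexive (cong (suc m *_) (*-comm m s))
... | greater u k rewrite +-∸-above s u k with suc k ≤? s
...   | yes k<s with b , refl ← m≤n⇒∃[o]m+o≡n k<s rewrite m+n∸m≡n (suc k) b =
  clique-weight-bound-above u k b hi
...   | no s≤k rewrite m≤n⇒m∸n≡0 (≰⇒≥ s≤k) | *-zeroʳ (suc (u + k)) | *-zeroʳ (suc u) = z≤n

heavy-edge-size : ∀ p s u l a → s + suc u ∸ suc (suc l) < a → p + s + suc u ∸ 1 ≤ p + a + l
heavy-edge-size p s u l a heavy rewrite +-suc (p + s) u | +-suc s u | +-assoc p s u | +-assoc p a l =
  +-monoʳ-≤ p (begin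
    s + u                     ≤⟨ m≤n+m∸n (s + u) (suc l) ⟩
    suc (l + (s + u ∸ suc l)) ≡⟨ +-suc l _ ⟨
    l + suc (s + u ∸ suc l)   ≤⟨ +-monoʳ-≤ l heavy ⟩
    l + a                     ≡⟨ +-comm l a ⟩
    a + l                     ∎)
  where open ≤-Reasoning

module _ {A : Set} where

  sum-map-+ : ∀ (f g : A → ℕ) xs → sum (map (λ x → f x + g x) xs) ≡ sum (map f xs) + sum (map g xs)
  sum-map-+ f g []       = refl
  sum-map-+ f g (x ∷ xs) rewrite sum-map-+ f g xs = interchange (f x) (g x) (sum (map f xs)) (sum (map g xs))

  sum-map-0 : ∀ (xs : List A) → sum (map (λ _ → 0) xs) ≡ 0
  sum-map-0 []       = refl
  sum-map-0 (_ ∷ xs) = sum-map-0 xs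

  *-distribˡ-sum-map : ∀ t (f : A → ℕ) xs → t * sum (map f xs) ≡ sum (map (λ x → t * f x) xs)
  *-distribˡ-sum-map t f []       = *-zeroʳ t
  *-distribˡ-sum-map t f (x ∷ xs) = trans (*-distribˡ-+ t (f x) _) (cong (t * f x +_) (*-distribˡ-sum-map t f xs))

  sum-map-filter-0< : ∀ (f : A → ℕ) xs → sum (map f (filter (λ x → 0 <? f x) xs)) ≡ sum (map f xs)
  sum-map-filter-0< f []       = refl
  sum-map-filter-0< f (x ∷ xs) with f x in fx≡
  ... | zero  = sum-map-filter-0< f xs
  ... | suc _ = cong₂ _+_ fx≡ (sum-map-filter-0< f xs)

  sum-map-≤ : ∀ b (f : A → ℕ) xs → All (λ x → f x ≤ b) xs → sum (map f xs) ≤ length xs * b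
  sum-map-≤ b f []       []             = z≤n
  sum-map-≤ b f (_ ∷ xs) (fx≤b ∷ fxs≤b) = +-mono-≤ fx≤b (sum-map-≤ b f xs fxs≤b)

  sum-map-< : ∀ b (f : A → ℕ) xs → 0 < length xs → (∀ x → b < f x) → length xs * b < sum (map f xs)
  sum-map-< b f (x ∷ [])     _ b<f = subst₂ _<_ (sym (+-identityʳ b)) (sym (+-identityʳ (f x))) (b<f x)
  sum-map-< b f (x ∷ y ∷ xs) _ b<f = +-mono-< (b<f x) (sum-map-< b f (y ∷ xs) z<s b<f)

module _ {A B : Set} where

  sum-map-comm : ∀ (h : A → B → ℕ) xs ys →
    sum (map (λ x → sum (map (h x) ys)) xs) ≡ sum (map (λ y → sum (map (λ x → h x y) xs)) ys)
  sum-map-comm h []       ys = sym (sum-map-0 ys)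
  sum-map-comm h (x ∷ xs) ys =
    trans (cong (sum (map (h x) ys) +_) (sum-map-comm h xs ys)) (sym (sum-map-+ (h x) _ ys))

-- toℚ k = + k / 1 normalises by gcd k 1, which does not compute for a variable k.
toℚ≡mkℚ : ∀ k → toℚ k ≡ mkℚ (ℤ.+ k) 0 (coprime-sym (1-coprimeTo k))
toℚ≡mkℚ k = ℚ.normalize-coprime (coprime-sym (1-coprimeTo k))

toℚ-mono : ∀ {a b} → a ≤ b → toℚ a ≤ℚ toℚ b
toℚ-mono {a} {b} a≤b rewrite toℚ≡mkℚ a | toℚ≡mkℚ b =
  *≤* (subst₂ ℤ._≤_ (sym (ℤ.*-identityʳ (ℤ.+ a))) (sym (ℤ.*-identityʳ (ℤ.+ b))) (ℤ.+≤+ a≤b))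

thr-1 : ∀ p → thr p 1 ≤ℚ 1ℚ
thr-1 p rewrite *-zeroʳ p = ℚ.≤-refl

separated⇒Dominates : ∀ c {L M} → All (c ≤ℚ_) L → All (_≤ℚ c) M → length L ≡ length M → Dominates L M
separated⇒Dominates c {L} {M} c≤L M≤c |L|≡|M| =
  pointwise (All-resp-↭ (↭-sym (sort-↭ L)) c≤L) (All-resp-↭ (↭-sym (sort-↭ M)) M≤c)
            (trans (↭-length (sort-↭ L)) (trans |L|≡|M| (sym (↭-length (sort-↭ M)))))
  where
  pointwise : ∀ {L M} → All (c ≤ℚ_) L → All (_≤ℚ c) M → length L ≡ length M → Pointwise (λ x y → y ≤ℚ x) L M
  pointwise {[]} {[]} [] [] _ = []
  pointwise {_ ∷ _} {_ ∷ _} (c≤x ∷ c≤L) (y≤c ∷ M≤c) eq =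
    ℚ.≤-trans y≤c c≤x ∷ pointwise c≤L M≤c (suc-injective eq)

length-filter-toℕ< : ∀ m k → k ≤ m → length (filter (λ i → toℕ i <? k) (allFin m)) ≡ k
length-filter-toℕ< m zero _ = none (allFin m)
  where
  none : ∀ {m} (xs : List (Fin m)) → length (filter (λ i → toℕ i <? 0) xs) ≡ 0
  none []       = refl
  none (_ ∷ xs) = none xs
length-filter-toℕ< (suc m) (suc k) (s≤s k≤m) = cong suc (begin
  length (filter (λ i → toℕ i <? suc k) (tabulate {n = m} suc))
    ≡⟨ cong (λ xs → length (filter (λ i → toℕ i <? suc k) xs)) (map-tabulate {n = m} (λ i → i) suc) ⟨
  length (filter (λ i → toℕ i <? suc k) (map suc (allFin m)))
    ≡⟨ shift (allFin m) ⟩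
  length (filter (λ i → toℕ i <? k) (allFin m))
    ≡⟨ length-filter-toℕ< m k k≤m ⟩
  k ∎)
  where
  open ≡-Reasoning
  shift : ∀ {m} (xs : List (Fin m)) →
    length (filter (λ i → toℕ i <? suc k) (map suc xs)) ≡ length (filter (λ i → toℕ i <? k) xs)
  shift []       = refl
  -- filter branches on the boolean toℕ x <ᵇ k that toℕ x <? k reduces to, so that is what must be abstracted.
  shift (x ∷ xs) with toℕ x <ᵇ k
  ... | true  = cong suc (shift xs)
  ... | false = shift xs

length-replicate-++-[] : ∀ {A : Set} {x y : A} n → length (replicate n x ++ y ∷ []) ≡ suc n
length-replicate-++-[] {x = x} n =
  trans (length-++ (replicate n x)) (trans (cong (_+ 1) (length-replicate n)) (+-comm n 1))

starExtension : ∀ {r} → ℕ → ℕ → Fin (suc (suc r)) → ℕ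
starExtension p a zero          = p
starExtension p a (suc zero)    = a
starExtension p a (suc (suc _)) = 1

size-starExtension : ∀ r p a → size (starExtension {r} p a) ≡ p + a + r
size-starExtension r p a = begin
  p + (a + sum (map (starExtension p a) (tabulate {n = r} (λ i → suc (suc i)))))
    ≡⟨ cong (λ xs → p + (a + sum xs)) (map-tabulate {n = r} (λ i → suc (suc i)) (starExtension p a)) ⟩
  p + (a + sum (tabulate {n = r} (λ _ → 1))) ≡⟨ cong (λ x → p + (a + x)) (sum-ones r) ⟩
  p + (a + r)                                ≡⟨ +-assoc p a r ⟨
  p + a + r                                  ∎
  where
  open ≡-Reasoning
  sum-ones : ∀ r → sum (tabulate {n = r} (λ _ → 1)) ≡ r
  sum-ones zero    = refl
  sum-ones (suc r) = cong suc (sum-ones r)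

positive⇒InGp : ∀ {p r} (H : WGraph p (suc (suc r))) → 1 ≤ p → Positive H →
  InGp (p + w H zero (suc zero) + r) H
positive⇒InGp {p} {r} H 1≤p pos =
  pos , Permutation.id , e , e-range , dominating , ≤-reflexive (sym (size-starExtension r p a))
  where
  a = w H zero (suc zero)
  e = starExtension p a

  e-range : ∀ v → 1 ≤ e v × e v ≤ p
  e-range zero          = 1≤p , ≤-refl
  e-range (suc zero)    = pos zero (suc zero) (λ ()) , w≤p H zero (suc zero)
  e-range (suc (suc _)) = ≤-refl , 1≤p

  below : Fin (suc (suc r)) → List (Fin (suc (suc r)))
  below j = filter (λ i → toℕ i <? toℕ j) (allFin _)

  all-below : ∀ j → All (λ i → toℕ i < toℕ j) (below j)
  all-below j = all-filter (λ i → toℕ i <? toℕ j) (allFin _)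

  length-below : ∀ j (f : Fin (suc (suc r)) → ℚ) → length (map f (below j)) ≡ toℕ j
  length-below j f = trans (length-map f (below j)) (length-filter-toℕ< _ (toℕ j) (<⇒≤ (toℕ<n j)))

  dominating : Dominating H Permutation.id e
  dominating zero ()
  dominating (suc zero) _ =
    separated⇒Dominates (toℚ a) (map⁺ (All.map only-zero (all-below (suc zero)))) (ℚ.≤-refl ∷ [])
      (length-below (suc zero) _)
    where
    only-zero : ∀ {i} → toℕ i < 1 → toℚ a ≤ℚ toℚ (w H i (suc zero))
    only-zero {zero} _ = ℚ.≤-refl
    only-zero {suc _} (s≤s ())
  dominating j@(suc (suc k)) _ =
    separated⇒Dominates 1ℚ (map⁺ (All.map edge-weight (all-below j)))
      (++⁺ (replicate⁺ (suc (toℕ k)) (thr-1 p)) (ℚ.≤-refl ∷ []))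
      (trans (length-below j _) (sym (length-replicate-++-[] (suc (toℕ k)))))
    where
    edge-weight : ∀ {i} → toℕ i < toℕ j → 1ℚ ≤ℚ toℚ (w H i j)
    edge-weight i<j = toℚ-mono (pos _ j (λ i≡j → <-irrefl (cong toℕ i≡j) i<j))

All-select : ∀ {A : Set} {P Q : A → Set} {xs} (x∈ : Any P xs) → All Q xs → All Q (Any.lookup x∈ ∷ (xs Any.─ x∈))
All-select x∈ Qxs = All.lookupWith (λ q _ → q) Qxs x∈ ∷ ─⁺ x∈ Qxs

module _ {A : Set} {R : A → A → Set} where

  AllPairs⇒lookup : Symmetric R → ∀ {xs} → AllPairs R xs → ∀ i j → i ≢ j → R (lookup xs i) (lookup xs j)
  AllPairs⇒lookup R-sym (Rx ∷ _)  zero    zero    i≢j = ⊥-elim (i≢j refl)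
  AllPairs⇒lookup R-sym (Rx ∷ _)  zero    (suc j) _   = All.lookup Rx (∈-lookup j)
  AllPairs⇒lookup R-sym (Rx ∷ _)  (suc i) zero    _   = R-sym (All.lookup Rx (∈-lookup i))
  AllPairs⇒lookup R-sym (_ ∷ Rxs) (suc i) (suc j) i≢j = AllPairs⇒lookup R-sym Rxs i j (i≢j ∘ cong suc)

  AllPairs⇒lookup-injective : Symmetric R → (∀ x → ¬ R x x) → ∀ {xs} → AllPairs R xs →
    ∀ i j → lookup xs i ≡ lookup xs j → i ≡ j
  AllPairs⇒lookup-injective R-sym irrefl Rxs i j eq with i ≟ᶠ j
  ... | yes i≡j = i≡j
  ... | no  i≢j = ⊥-elim (irrefl _ (subst (R _) (sym eq) (AllPairs⇒lookup R-sym Rxs i j i≢j)))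

  AllPairs-select : Symmetric R → ∀ {P : A → Set} {xs} (x∈ : Any P xs) → AllPairs R xs →
    AllPairs R (Any.lookup x∈ ∷ (xs Any.─ x∈))
  AllPairs-select R-sym (here _)  Rxs = Rxs
  AllPairs-select R-sym (there x∈) (Rx ∷ Rxs) with AllPairs-select R-sym x∈ Rxs
  ... | Ry ∷ Rys = (R-sym (All.lookupWith (λ r _ → r) Rx x∈) ∷ Ry) ∷ ─⁺ x∈ Rx ∷ Rys

module GreedyClique {A : Set} {R : A → A → Set} (R? : Decidable R) where

  extend : List A → List A → List A
  extend K []       = K
  extend K (y ∷ ys) with all? (R? y) K
  ... | yes _ = extend (y ∷ K) ys
  ... | no  _ = extend K ys

  greedyClique : List A → List A
  greedyClique = extend []

  extend-AllPairs : ∀ K ys → AllPairs R K → AllPairs R (extend K ys)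
  extend-AllPairs K []       RK = RK
  extend-AllPairs K (y ∷ ys) RK with all? (R? y) K
  ... | yes Ry = extend-AllPairs (y ∷ K) ys (Ry ∷ RK)
  ... | no  _  = extend-AllPairs K ys RK

  extend-Any : ∀ {P : A → Set} K ys → Any P K → Any P (extend K ys)
  extend-Any K []       PK = PK
  extend-Any K (y ∷ ys) PK with all? (R? y) K
  ... | yes _ = extend-Any (y ∷ K) ys (there PK)
  ... | no  _ = extend-Any K ys PK

  extend-maximal : (∀ x → ¬ R x x) → ∀ K {ys y} → y ∈ ys → Any (λ z → ¬ R y z) (extend K ys)
  extend-maximal irrefl K {y ∷ ys} (here refl) with all? (R? y) K
  ... | yes _  = extend-Any (y ∷ K) ys (here (irrefl y))
  ... | no  ¬R = extend-Any K ys (¬All⇒Any¬ (R? y) K ¬R)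
  extend-maximal irrefl K {y′ ∷ ys} (there y∈) with all? (R? y′) K
  ... | yes _ = extend-maximal irrefl (y′ ∷ K) y∈
  ... | no  _ = extend-maximal irrefl K y∈

  greedyClique-AllPairs : ∀ ys → AllPairs R (greedyClique ys)
  greedyClique-AllPairs ys = extend-AllPairs [] ys []

  greedyClique-maximal : (∀ x → ¬ R x x) → ∀ {ys y} → y ∈ ys → Any (λ z → ¬ R y z) (greedyClique ys)
  greedyClique-maximal irrefl = extend-maximal irrefl []

Adj : ∀ {p n} → WGraph p n → Fin n → Fin n → Set
Adj G x y = 0 < w G x y

Adj? : ∀ {p n} (G : WGraph p n) → Decidable (Adj G)
Adj? G x y = 0 <? w G x y

Adj-sym : ∀ {p n} (G : WGraph p n) → Symmetric (Adj G)
Adj-sym G {x} {y} = subst (0 <_) (wsym G x y)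

Adj-irrefl : ∀ {p n} (G : WGraph p n) x → ¬ Adj G x x
Adj-irrefl G x rewrite wdiag G x = n≮0

HasInducedGp : ∀ {p n} → ℕ → WGraph p n → Set
HasInducedGp {n = n} q G =
  Σ ℕ λ m → Σ (Fin m → Fin n) λ f → Σ (∀ i j → f i ≡ f j → i ≡ j) λ inj → InGp q (induced G f inj)

HasInducedGp-mono : ∀ {p n q q′} {G : WGraph p n} → q ≤ q′ → HasInducedGp q′ G → HasInducedGp q G
HasInducedGp-mono q≤q′ (m , f , inj , pos , σ , e , range , dom , q′≤size) =
  m , f , inj , pos , σ , e , range , dom , ≤-trans q≤q′ q′≤size

clique⇒HasInducedGp : ∀ {p n} (G : WGraph p n) → 1 ≤ p → ∀ x y zs → AllPairs (Adj G) (x ∷ y ∷ zs) →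
  HasInducedGp (p + w G x y + length zs) G
clique⇒HasInducedGp G 1≤p x y zs clique =
  _ , lookup xs , inj , positive⇒InGp (induced G (lookup xs) inj) 1≤p (AllPairs⇒lookup (Adj-sym G) clique)
  where
  xs = x ∷ y ∷ zs
  inj = AllPairs⇒lookup-injective (Adj-sym G) (Adj-irrefl G) clique

deg≡sum : ∀ {p n} (G : WGraph p n) x → deg G x ≡ sum (map (w G x) (allFin n))
deg≡sum G x = cong sum (map-cong off-diagonal (allFin _))
  where
  off-diagonal : ∀ y → (if ⌊ x ≟ᶠ y ⌋ then 0 else w G x y) ≡ w G x y
  off-diagonal y with x ≟ᶠ y
  ... | yes refl = sym (wdiag G x)
  ... | no  _    = refl

module DensityArgument {p n} (G : WGraph p n) (s u : ℕ) where
  open GreedyClique (Adj? G)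

  K : List (Fin n)
  K = greedyClique (allFin n)

  K-clique : AllPairs (Adj G) K
  K-clique = greedyClique-AllPairs (allFin n)

  neighbours : Fin n → List (Fin n)
  neighbours y = filter (Adj? G y) K

  |neighbours|<|K| : ∀ y → length (neighbours y) < length K
  |neighbours|<|K| y = filter-notAll (Adj? G y) K (greedyClique-maximal (Adj-irrefl G) (∈-allFin y))

  threshold : Fin n → ℕ
  threshold y = s + suc u ∸ suc (length (neighbours y))

  Heavy : Fin n → Set
  Heavy y = Any (λ x → threshold y < w G y x) (neighbours y)

  Heavy? : ∀ y → Dec (Heavy y)
  Heavy? y = Any.any? (λ x → threshold y <? w G y x) (neighbours y)

  heavy⇒HasInducedGp : 1 ≤ p → ∀ y → Heavy y → HasInducedGp (p + s + suc u ∸ 1) G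
  heavy⇒HasInducedGp 1≤p y heavy =
    HasInducedGp-mono {G = G} size-bound (clique⇒HasInducedGp G 1≤p y x rest (y-adjacent ∷ x-clique))
    where
    x    = Any.lookup heavy
    rest = neighbours y Any.─ heavy
    y-adjacent : All (Adj G y) (x ∷ rest)
    y-adjacent = All-select heavy (all-filter (Adj? G y) K)
    x-clique : AllPairs (Adj G) (x ∷ rest)
    x-clique = AllPairs-select (Adj-sym G) heavy (AllPairs.filter⁺ (Adj? G y) K-clique)
    |neighbours|≡1+|rest| : length (neighbours y) ≡ suc (length rest)
    |neighbours|≡1+|rest| = length-removeAt′ (neighbours y) (Any.index heavy)
    size-bound : p + s + suc u ∸ 1 ≤ p + w G y x + length rest
    size-bound = heavy-edge-size p s u (length rest) (w G y x)
      (subst (λ l → s + suc u ∸ suc l < w G y x) |neighbours|≡1+|rest| (lookup-result heavy))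

  weightInto : Fin n → ℕ
  weightInto y = sum (map (w G y) K)

  light-weightInto : suc u * (u ∸ 1) ≤ s → s ≤ suc u * suc u → ∀ y → ¬ Heavy y →
    suc u * weightInto y ≤ length K * (s * u)
  light-weightInto lo hi y light = begin
    suc u * weightInto y                     ≡⟨ cong (suc u *_) (sum-map-filter-0< (w G y) K) ⟨
    suc u * sum (map (w G y) (neighbours y)) ≤⟨ *-monoʳ-≤ (suc u) (sum-map-≤ (threshold y) (w G y) _ below) ⟩
    suc u * (l * (s + suc u ∸ suc l))        ≤⟨ clique-weight-bound l lo hi ⟩
    suc l * (s * u)                          ≤⟨ *-monoˡ-≤ (s * u) (|neighbours|<|K| y) ⟩
    length K * (s * u)                       ∎
    where
    open ≤-Reasoning
    l = length (neighbours y)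
    below : All (λ x → w G y x ≤ threshold y) (neighbours y)
    below = All.map ≮⇒≥ (¬Any⇒All¬ (neighbours y) light)

  sum-deg-K : sum (map (deg G) K) ≡ sum (map weightInto (allFin n))
  sum-deg-K = begin
    sum (map (deg G) K)                                     ≡⟨ cong sum (map-cong deg≡weights K) ⟩
    sum (map (λ x → sum (map (λ y → w G y x) (allFin n))) K) ≡⟨ sum-map-comm (λ x y → w G y x) K (allFin n) ⟩
    sum (map weightInto (allFin n))                         ∎
    where
    open ≡-Reasoning
    deg≡weights : ∀ x → deg G x ≡ sum (map (λ y → w G y x) (allFin n))
    deg≡weights x = trans (deg≡sum G x) (cong sum (map-cong (wsym G x) (allFin n)))

  light⇒¬dense : suc u * (u ∸ 1) ≤ s → s ≤ suc u * suc u → (∀ y → ¬ Heavy y) → Fin n →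
    ¬ (∀ x → s * u * n < suc u * deg G x)
  light⇒¬dense lo hi light y₀ dense = <-irrefl refl (<-≤-trans lower upper)
    where
    k = length K
    lower : k * (s * u * n) < suc u * sum (map (deg G) K)
    lower = subst (k * (s * u * n) <_) (sym (*-distribˡ-sum-map (suc u) (deg G) K))
      (sum-map-< (s * u * n) (λ x → suc u * deg G x) K (≤-<-trans z≤n (|neighbours|<|K| y₀)) dense)
    upper : suc u * sum (map (deg G) K) ≤ k * (s * u * n)
    upper = begin
      suc u * sum (map (deg G) K)
        ≡⟨ cong (suc u *_) sum-deg-K ⟩
      suc u * sum (map weightInto (allFin n))
        ≡⟨ *-distribˡ-sum-map (suc u) weightInto (allFin n) ⟩
      sum (map (λ y → suc u * weightInto y) (allFin n))
        ≤⟨ sum-map-≤ _ _ (allFin n) (All.tabulate λ {y} _ → light-weightInto lo hi y (light y)) ⟩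
      length (allFin n) * (k * (s * u))
        ≡⟨ cong (_* (k * (s * u))) (length-tabulate {n = n} (λ i → i)) ⟩
      n * (k * (s * u))
        ≡⟨ rearrange n k (s * u) ⟩
      k * (s * u * n)
        ∎
      where
      open ≤-Reasoning
      rearrange : ∀ n k c → n * (k * c) ≡ k * (c * n)
      rearrange = solve-∀

lemma5p10 : (p s t : ℕ) → 1 ≤ p → 1 ≤ s → 1 ≤ t →
    t * (t ∸ 2) ≤ s → s ≤ t * t → s + t ∸ 1 ≤ p →
    (n : ℕ) → 1 ≤ n → (G : WGraph p n) →
    (∀ x → s * (t ∸ 1) * n < t * deg G x) →
    Σ ℕ λ m → Σ (Fin m → Fin n) λ f → Σ (∀ i j → f i ≡ f j → i ≡ j) λ inj →
      InGp (p + s + t ∸ 1) (induced G f inj)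
lemma5p10 p s (suc u) 1≤p _ _ lo hi _ n 1≤n G dense = case any? Heavy? of λ where
    (yes (y , heavy)) → heavy⇒HasInducedGp 1≤p y heavy
    (no  no-heavy)    → ⊥-elim (light⇒¬dense lo hi (λ y heavy → no-heavy (y , heavy)) (fromℕ< 1≤n) dense)
  where open DensityArgument G s u
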